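{- Let $m>2$ be an integer and let $Q_m$ be constructed as follows: let $X_1$ be a copy of the complete graph $K_{m-1}$; let $X_2$ be any $(m-2)$-regular graph on $m+1$ vertices; let $X$ be the disjoint union of $X_1$ and $X_2$; let $Y$ be a set of $m+2$ new vertices with no edges among them; and let $Q_m$ be the graph on $V(X)\cup Y$ whose edges are those of $X$ together with all edges $xy$ with $x\in V(X)$, $y\in Y$. (Thus $Q_m$ is $2m$-regular on $3m+2$ vertices.) Then $Q_m$ has no internal partition.
   Context: Graphs are finite and simple. For $S\subseteq V$, $d_S(v)$ is the number of neighbors of $v$ in $S$ and $d(v)$ the degree of $v$. An internal partition is a partition $V=A\dot\cup B$ with $A,B\ne\emptyset$ such that $d_A(x)\ge d(x)/2$ for all $x\in A$ and $d_B(x)\ge d(x)/2$ for all $x\in B$. -}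

module Defs where

open import Data.Nat using (ℕ; zero; suc; _+_; _*_; _∸_; _≤_)
open import Data.Bool using (Bool; true; false; not; _∧_)
open import Data.Fin using (Fin; zero; suc; splitAt)
open import Data.Fin.Properties using (_≟_)
open import Data.Sum using (_⊎_; inj₁; inj₂)
open import Data.Product using (∃; _×_)
open import Relation.Nullary.Decidable using (⌊_⌋)
open import Relation.Binary.PropositionalEquality using (_≡_; refl) renaming (sym to ≡-sym)
open import Relation.Nullary using (yes; no)
open import Data.Empty using (⊥-elim)

record SimpleGraph (n : ℕ) : Set where
  field
    adj    : Fin n → Fin n → Bool
    sym    : ∀ x y → adj x y ≡ adj y x
    irrefl : ∀ x → adj x x ≡ false
open SimpleGraph public

count : ∀ {n} → (Fin n → Bool) → ℕ
count {zero}  P = 0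
count {suc n} P with P zero
... | true  = suc (count (λ i → P (suc i)))
... | false = count (λ i → P (suc i))

deg : ∀ {n} → SimpleGraph n → Fin n → ℕ
deg G v = count (λ u → adj G v u)

degIn : ∀ {n} → SimpleGraph n → (Fin n → Bool) → Fin n → ℕ
degIn G S v = count (λ u → S u ∧ adj G v u)

Regular : ∀ {n} → ℕ → SimpleGraph n → Set
Regular k G = ∀ v → deg G v ≡ k

-- An internal partition V = A ⊔ B, with A = {x | A x = true},
-- B = {x | A x = false}; both nonempty; d_A(x) ≥ d(x)/2 for x ∈ A and
-- d_B(x) ≥ d(x)/2 for x ∈ B (written as d(x) ≤ 2 d_S(x)).
record InternalPartition {n : ℕ} (G : SimpleGraph n) : Set where
  field
    A        : Fin n → Bool
    A-nonempty : ∃ λ a → A a ≡ true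
    B-nonempty : ∃ λ b → A b ≡ false
    A-ok     : ∀ x → A x ≡ true  → deg G x ≤ 2 * degIn G A x
    B-ok     : ∀ x → A x ≡ false → deg G x ≤ 2 * degIn G (λ y → not (A y)) x

-- Vertex set of Q_m: Fin ((m-1) + ((m+1) + (m+2))),
-- first block X₁ (K_{m-1}), second block X₂, third block Y.
QV : ℕ → ℕ
QV m = (m ∸ 1) + (suc m + suc (suc m))

data Part (m : ℕ) : Set where
  inX₁ : Fin (m ∸ 1) → Part m
  inX₂ : Fin (suc m) → Part m
  inY  : Fin (suc (suc m)) → Part m

part : ∀ m → Fin (QV m) → Part m
part m v with splitAt (m ∸ 1) v
... | inj₁ i = inX₁ i
... | inj₂ w with splitAt (suc m) w
...   | inj₁ j = inX₂ j
...   | inj₂ k = inY k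

QAdjP : ∀ {m} → SimpleGraph (suc m) → Part m → Part m → Bool
QAdjP X₂ (inX₁ i) (inX₁ j) = not ⌊ i ≟ j ⌋
QAdjP X₂ (inX₂ i) (inX₂ j) = adj X₂ i j
QAdjP X₂ (inX₁ _) (inX₂ _) = false
QAdjP X₂ (inX₂ _) (inX₁ _) = false
QAdjP X₂ (inX₁ _) (inY _)  = true
QAdjP X₂ (inX₂ _) (inY _)  = true
QAdjP X₂ (inY _)  (inX₁ _) = true
QAdjP X₂ (inY _)  (inX₂ _) = true
QAdjP X₂ (inY _)  (inY _)  = false

private
  notDec-sym : ∀ {k} (i j : Fin k) → not ⌊ i ≟ j ⌋ ≡ not ⌊ j ≟ i ⌋
  notDec-sym i j with i ≟ j | j ≟ i
  ... | yes _ | yes _ = refl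
  ... | no _  | no _  = refl
  ... | yes p | no q  = ⊥-elim (q (≡-sym p))
  ... | no q  | yes p = ⊥-elim (q (≡-sym p))

  notDec-refl : ∀ {k} (i : Fin k) → not ⌊ i ≟ i ⌋ ≡ false
  notDec-refl i with i ≟ i
  ... | yes _ = refl
  ... | no q  = ⊥-elim (q refl)

  QAdjP-sym : ∀ {m} (X₂ : SimpleGraph (suc m)) p q → QAdjP X₂ p q ≡ QAdjP X₂ q p
  QAdjP-sym X₂ (inX₁ i) (inX₁ j) = notDec-sym i j
  QAdjP-sym X₂ (inX₂ i) (inX₂ j) = sym X₂ i j
  QAdjP-sym X₂ (inX₁ _) (inX₂ _) = refl
  QAdjP-sym X₂ (inX₂ _) (inX₁ _) = refl
  QAdjP-sym X₂ (inX₁ _) (inY _)  = refl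
  QAdjP-sym X₂ (inX₂ _) (inY _)  = refl
  QAdjP-sym X₂ (inY _)  (inX₁ _) = refl
  QAdjP-sym X₂ (inY _)  (inX₂ _) = refl
  QAdjP-sym X₂ (inY _)  (inY _)  = refl

  QAdjP-irrefl : ∀ {m} (X₂ : SimpleGraph (suc m)) p → QAdjP X₂ p p ≡ false
  QAdjP-irrefl X₂ (inX₁ i) = notDec-refl i
  QAdjP-irrefl X₂ (inX₂ i) = irrefl X₂ i
  QAdjP-irrefl X₂ (inY _)  = refl

Q : (m : ℕ) → SimpleGraph (suc m) → SimpleGraph (QV m)
Q m X₂ = record
  { adj    = λ x y → QAdjP X₂ (part m x) (part m y)
  ; sym    = λ x y → QAdjP-sym X₂ (part m x) (part m y)
  ; irrefl = λ x → QAdjP-irrefl X₂ (part m x)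
  }

module Submission where

-- Call a split V = S ⊔ T cohesive when every vertex has at
-- least as many neighbours on its own side as on the other one; an
-- internal partition is exactly a cohesive split with both sides nonempty.
-- Let Q_m have blocks X₁ ≅ K_{m-1}, X₂ (d-regular, d ≥ 1) and Y, and let
-- s₁, s₂, s_Y and t₁, t₂, t_Y be the sizes of S and T inside them.  For a
-- cohesive split of Q_m:
--  (1) a vertex of T ∩ X has at most m+1 neighbours in X but m+2 in Y
--      if Y ⊆ S, so T ≠ ∅ forces T to meet Y (and symmetrically for S);
--  (2) a vertex of S ∩ X₁ forces t₁ + t_Y < s₁ + s_Y, so X₁ never meets
--      both sides;
--  (3) if X₁ ⊆ S and Y meets both sides, the two Y-vertices give
--      t₂ = (m-1) + s₂, hence s₂ = 1 because s₂ + t₂ = m+1;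
--  (4) the unique vertex v of S ∩ X₂ has all its X₂-neighbours in T,
--      whence s_Y ≥ d + t_Y; but then any X₂-neighbour w of v (which lies
--      in T) has more neighbours in S than in T.  The hypothesis m > 2 only serves to
-- make X₁ nonempty and the degree m-2 of X₂ positive.

open import Defs
open import Data.Nat using (ℕ; zero; suc; _+_; _*_; _∸_; _≤_; _<_; z≤n; s≤s; s≤s⁻¹)
open import Data.Nat.Properties
  using (≤-trans; ≤-antisym; ≤-reflexive; <-asym; <-irrefl; n≤1+n; m≤n⇒m≤1+n;
         m≤n+m; m∸n≤m; +-identityʳ; +-suc; +-comm; +-cancelˡ-≤;
         +-monoˡ-≤; +-monoʳ-≤; n≤0⇒n≡0; 1+n≰n; m+1+n≰m; module ≤-Reasoning)
open import Data.Bool using (Bool; true; false; not; _∧_)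
open import Data.Bool.Properties using (∧-zeroʳ; ∧-identityʳ; not-involutive)
open import Data.Fin using (Fin; zero; suc; _↑ˡ_; _↑ʳ_; splitAt)
open import Data.Fin.Properties using (_≟_; splitAt-↑ˡ; splitAt-↑ʳ; splitAt⁻¹-↑ˡ; splitAt⁻¹-↑ʳ)
open import Data.Sum using (inj₁; inj₂)
open import Data.Product using (∃; _×_; _,_; proj₁; proj₂)
open import Data.Empty using (⊥; ⊥-elim)
open import Relation.Nullary using (¬_; yes; no)
open import Relation.Nullary.Decidable using (⌊_⌋)
open import Relation.Binary.PropositionalEquality
  using (_≡_; refl; trans; cong; cong₂; subst; subst₂; module ≡-Reasoning) renaming (sym to ≡-sym)

∧-true : ∀ {a b} → a ≡ true → b ≡ true → a ∧ b ≡ true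
∧-true refl refl = refl

∧-trueˡ : ∀ {a b} → a ∧ b ≡ true → a ≡ true
∧-trueˡ {true} _ = refl

not-true : ∀ {b} → not b ≡ true → b ≡ false
not-true {false} _ = refl

count-ext : ∀ {k} {P Q : Fin k → Bool} → (∀ i → P i ≡ Q i) → count P ≡ count Q
count-ext {zero} _ = refl
count-ext {suc k} {P} {Q} e with P zero | Q zero | e zero
... | true  | true  | refl = cong suc (count-ext (λ i → e (suc i)))
... | false | false | refl = count-ext (λ i → e (suc i))

count-split : ∀ a b (P : Fin (a + b) → Bool) →
  count P ≡ count (λ i → P (i ↑ˡ b)) + count (λ j → P (a ↑ʳ j))
count-split zero    b P = refl
count-split (suc a) b P with P zero
... | true  = cong suc (count-split a b (λ i → P (suc i)))
... | false = count-split a b (λ i → P (suc i))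

count-false : ∀ {k} {P : Fin k → Bool} → (∀ i → P i ≡ false) → count P ≡ 0
count-false {zero} _ = refl
count-false {suc k} {P} e with P zero | e zero
... | false | refl = count-false (λ i → e (suc i))

count-true : ∀ {k} {P : Fin k → Bool} → (∀ i → P i ≡ true) → count P ≡ k
count-true {zero} _ = refl
count-true {suc k} {P} e with P zero | e zero
... | true | refl = cong suc (count-true (λ i → e (suc i)))

count-≤ : ∀ {k} (P : Fin k → Bool) → count P ≤ k
count-≤ {zero}  P = z≤n
count-≤ {suc k} P with P zero
... | true  = s≤s (count-≤ (λ i → P (suc i)))
... | false = m≤n⇒m≤1+n (count-≤ (λ i → P (suc i)))

count-mono : ∀ {k} (P Q : Fin k → Bool) → (∀ i → P i ≡ true → Q i ≡ true) →
  count P ≤ count Q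
count-mono {zero}  P Q h = z≤n
count-mono {suc k} P Q h with P zero in ep | Q zero in eq
... | true  | true  = s≤s (count-mono _ _ (λ i → h (suc i)))
... | false | true  = m≤n⇒m≤1+n (count-mono _ _ (λ i → h (suc i)))
... | false | false = count-mono _ _ (λ i → h (suc i))
... | true  | false with trans (≡-sym eq) (h zero ep)
...   | ()

count-strict : ∀ {k} (P Q : Fin k → Bool) → (∀ i → P i ≡ true → Q i ≡ true) →
  ∀ v → Q v ≡ true → P v ≡ false → count P < count Q
count-strict {suc k} P Q h zero qv pv with P zero in ep | Q zero in eq
count-strict {suc k} P Q h zero qv pv | false | true = s≤s (count-mono _ _ (λ i → h (suc i)))
count-strict {suc k} P Q h zero qv () | true  | _
count-strict {suc k} P Q h zero () pv | false | false
count-strict {suc k} P Q h (suc v) qv pv with P zero in ep | Q zero in eq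
... | true  | true  = s≤s (count-strict _ _ (λ i → h (suc i)) v qv pv)
... | false | true  = m≤n⇒m≤1+n (count-strict _ _ (λ i → h (suc i)) v qv pv)
... | false | false = count-strict _ _ (λ i → h (suc i)) v qv pv
... | true  | false with trans (≡-sym eq) (h zero ep)
...   | ()

count-pos : ∀ {k} (P : Fin k → Bool) i → P i ≡ true → 1 ≤ count P
count-pos {suc k} P zero    e with P zero
... | true = s≤s z≤n
count-pos {suc k} P zero () | false
count-pos {suc k} P (suc i) e with P zero
... | true  = s≤s z≤n
... | false = count-pos (λ j → P (suc j)) i e

count-ex : ∀ {k} (P : Fin k → Bool) → 1 ≤ count P → ∃ λ i → P i ≡ true
count-ex {suc k} P h with P zero in eq
... | true  = zero , eq
... | false with count-ex (λ j → P (suc j)) h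
...   | i , e = suc i , e

count-∧-split : ∀ {k} {S T : Fin k → Bool} → (∀ i → T i ≡ not (S i)) → (P : Fin k → Bool) →
  count P ≡ count (λ i → S i ∧ P i) + count (λ i → T i ∧ P i)
count-∧-split {zero} _ P = refl
count-∧-split {suc k} {S} {T} c P with S zero | T zero | c zero | P zero
... | true  | false | refl | true  = cong suc (count-∧-split (λ i → c (suc i)) (λ i → P (suc i)))
... | true  | false | refl | false = count-∧-split (λ i → c (suc i)) (λ i → P (suc i))
... | false | true  | refl | true  =
  trans (cong suc (count-∧-split (λ i → c (suc i)) (λ i → P (suc i)))) (≡-sym (+-suc _ _))
... | false | true  | refl | false = count-∧-split (λ i → c (suc i)) (λ i → P (suc i))

count-complement : ∀ {k} {S T : Fin k → Bool} → (∀ i → T i ≡ not (S i)) →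
  count S + count T ≡ k
count-complement {k} {S} {T} c = begin
  count S + count T
    ≡⟨ cong₂ _+_ (count-ext (λ i → ≡-sym (∧-identityʳ (S i)))) (count-ext (λ i → ≡-sym (∧-identityʳ (T i)))) ⟩
  count (λ i → S i ∧ true) + count (λ i → T i ∧ true)
    ≡⟨ ≡-sym (count-∧-split c (λ _ → true)) ⟩
  count {k} (λ _ → true)
    ≡⟨ count-true (λ _ → refl) ⟩
  k ∎
  where open ≡-Reasoning

without : ∀ {k} → Fin k → (Fin k → Bool) → Fin k → Bool
without i P j = P j ∧ not ⌊ i ≟ j ⌋

count-without-absent : ∀ {k} (P : Fin k → Bool) i → P i ≡ false → count (without i P) ≡ count P
count-without-absent P i pi = count-ext same
  where
  same : ∀ j → without i P j ≡ P j
  same j with i ≟ j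
  ... | yes refl = trans (∧-zeroʳ (P i)) (≡-sym pi)
  ... | no _     = ∧-identityʳ (P j)

count-without-present : ∀ {k} (P : Fin k → Bool) i → P i ≡ true → count (without i P) < count P
count-without-present P i pi = count-strict (without i P) P (λ j → ∧-trueˡ) i pi removed
  where
  removed : without i P i ≡ false
  removed with i ≟ i
  ... | yes _  = ∧-zeroʳ (P i)
  ... | no i≢i = ⊥-elim (i≢i refl)

record CohesiveSplit {n : ℕ} (G : SimpleGraph n) : Set where
  field
    S T        : Fin n → Bool
    complement : ∀ x → T x ≡ not (S x)
    S-cohesive : ∀ x → S x ≡ true → degIn G T x ≤ degIn G S x
    T-cohesive : ∀ x → T x ≡ true → degIn G S x ≤ degIn G T x

  S-false⇒T : ∀ x → S x ≡ false → T x ≡ true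
  S-false⇒T x sx rewrite complement x | sx = refl

  disjoint : ∀ x → S x ≡ true → T x ≡ false
  disjoint x sx rewrite complement x | sx = refl

-- Exchanging the roles of the two sides, which lets every argument below be
-- run with S and T interchanged.
swap : ∀ {n} {G : SimpleGraph n} → CohesiveSplit G → CohesiveSplit G
swap σ = record
  { S          = T
  ; T          = S
  ; complement = λ x → trans (≡-sym (not-involutive (S x))) (cong not (≡-sym (complement x)))
  ; S-cohesive = T-cohesive
  ; T-cohesive = S-cohesive
  }
  where open CohesiveSplit σ

-- d ≤ 2p with d = p + q means q ≤ p: "at least half" is "at least as many".
≤-half : ∀ {d p q} → d ≡ p + q → d ≤ 2 * p → q ≤ p
≤-half {p = p} {q} refl d≤2p = subst (q ≤_) (+-identityʳ p) (+-cancelˡ-≤ p q (p + 0) d≤2p)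

internal⇒cohesive : ∀ {n} {G : SimpleGraph n} → InternalPartition G → CohesiveSplit G
internal⇒cohesive {n} {G} ip = record
  { S          = A
  ; T          = B
  ; complement = λ _ → refl
  ; S-cohesive = λ x ax → ≤-half (deg-split x) (A-ok x ax)
  ; T-cohesive = λ x bx → ≤-half (trans (deg-split x) (+-comm (degIn G A x) (degIn G B x)))
                                 (B-ok x (not-true bx))
  }
  where
  open InternalPartition ip
  B : Fin n → Bool
  B y = not (A y)
  deg-split : ∀ x → deg G x ≡ degIn G A x + degIn G B x
  deg-split x = count-∧-split (λ _ → refl) (adj G x)

module Blocks (m : ℕ) (X₂ : SimpleGraph (suc m)) where

  ι₁ : Fin (m ∸ 1) → Fin (QV m)
  ι₁ i = i ↑ˡ (suc m + suc (suc m))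

  ι₂ : Fin (suc m) → Fin (QV m)
  ι₂ j = (m ∸ 1) ↑ʳ (j ↑ˡ suc (suc m))

  ιY : Fin (suc (suc m)) → Fin (QV m)
  ιY k = (m ∸ 1) ↑ʳ (suc m ↑ʳ k)

  part-ι₁ : ∀ i → part m (ι₁ i) ≡ inX₁ i
  part-ι₁ i rewrite splitAt-↑ˡ (m ∸ 1) i (suc m + suc (suc m)) = refl

  part-ι₂ : ∀ j → part m (ι₂ j) ≡ inX₂ j
  part-ι₂ j rewrite splitAt-↑ʳ (m ∸ 1) (suc m + suc (suc m)) (j ↑ˡ suc (suc m))
                  | splitAt-↑ˡ (suc m) j (suc (suc m)) = refl

  part-ιY : ∀ k → part m (ιY k) ≡ inY k
  part-ιY k rewrite splitAt-↑ʳ (m ∸ 1) (suc m + suc (suc m)) (suc m ↑ʳ k)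
                  | splitAt-↑ʳ (suc m) (suc (suc m)) k = refl

  data BlockView : Fin (QV m) → Set where
    atX₁ : ∀ i → BlockView (ι₁ i)
    atX₂ : ∀ j → BlockView (ι₂ j)
    atY  : ∀ k → BlockView (ιY k)

  block : ∀ v → BlockView v
  block v with splitAt (m ∸ 1) v in e
  ... | inj₁ i = subst BlockView (splitAt⁻¹-↑ˡ e) (atX₁ i)
  ... | inj₂ w with splitAt (suc m) w in e′
  ...   | inj₁ j = subst BlockView (trans (cong ((m ∸ 1) ↑ʳ_) (splitAt⁻¹-↑ˡ e′)) (splitAt⁻¹-↑ʳ e)) (atX₂ j)
  ...   | inj₂ k = subst BlockView (trans (cong ((m ∸ 1) ↑ʳ_) (splitAt⁻¹-↑ʳ e′)) (splitAt⁻¹-↑ʳ e)) (atY k)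

  count-blocks : (P : Fin (QV m) → Bool) →
    count P ≡ count (λ i → P (ι₁ i)) + (count (λ j → P (ι₂ j)) + count (λ k → P (ιY k)))
  count-blocks P = trans (count-split (m ∸ 1) _ P)
    (cong (count (λ i → P (ι₁ i)) +_) (count-split (suc m) (suc (suc m)) (λ w → P ((m ∸ 1) ↑ʳ w))))

  size₁ : (Fin (QV m) → Bool) → ℕ
  size₁ S = count (λ i → S (ι₁ i))

  size₂ : (Fin (QV m) → Bool) → ℕ
  size₂ S = count (λ j → S (ι₂ j))

  sizeY : (Fin (QV m) → Bool) → ℕ
  sizeY S = count (λ k → S (ιY k))

  nbr₁ : (Fin (QV m) → Bool) → Fin (m ∸ 1) → ℕ
  nbr₁ S i = count (without i (λ j → S (ι₁ j)))

  nbr₂ : (Fin (QV m) → Bool) → Fin (suc m) → ℕ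
  nbr₂ S i = count (λ j → S (ι₂ j) ∧ adj X₂ i j)

  G : SimpleGraph (QV m)
  G = Q m X₂

  degIn-X₁ : ∀ S i → degIn G S (ι₁ i) ≡ nbr₁ S i + sizeY S
  degIn-X₁ S i = trans (count-blocks _) (cong₂ _+_ (count-ext in-X₁) (cong₂ _+_ (count-false in-X₂) (count-ext in-Y)))
    where
    in-X₁ : ∀ j → S (ι₁ j) ∧ adj G (ι₁ i) (ι₁ j) ≡ S (ι₁ j) ∧ not ⌊ i ≟ j ⌋
    in-X₁ j rewrite part-ι₁ i | part-ι₁ j = refl
    in-X₂ : ∀ j → S (ι₂ j) ∧ adj G (ι₁ i) (ι₂ j) ≡ false
    in-X₂ j rewrite part-ι₁ i | part-ι₂ j = ∧-zeroʳ _
    in-Y : ∀ k → S (ιY k) ∧ adj G (ι₁ i) (ιY k) ≡ S (ιY k)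
    in-Y k rewrite part-ι₁ i | part-ιY k = ∧-identityʳ _

  degIn-X₂ : ∀ S j → degIn G S (ι₂ j) ≡ nbr₂ S j + sizeY S
  degIn-X₂ S j = trans (count-blocks _) (cong₂ _+_ (count-false in-X₁) (cong₂ _+_ (count-ext in-X₂) (count-ext in-Y)))
    where
    in-X₁ : ∀ i → S (ι₁ i) ∧ adj G (ι₂ j) (ι₁ i) ≡ false
    in-X₁ i rewrite part-ι₂ j | part-ι₁ i = ∧-zeroʳ _
    in-X₂ : ∀ i → S (ι₂ i) ∧ adj G (ι₂ j) (ι₂ i) ≡ S (ι₂ i) ∧ adj X₂ j i
    in-X₂ i rewrite part-ι₂ j | part-ι₂ i = refl
    in-Y : ∀ k → S (ιY k) ∧ adj G (ι₂ j) (ιY k) ≡ S (ιY k)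
    in-Y k rewrite part-ι₂ j | part-ιY k = ∧-identityʳ _

  degIn-Y : ∀ S k → degIn G S (ιY k) ≡ size₁ S + size₂ S
  degIn-Y S k = trans (count-blocks _)
    (trans (cong₂ _+_ (count-ext in-X₁) (cong₂ _+_ (count-ext in-X₂) (count-false in-Y)))
           (cong (size₁ S +_) (+-identityʳ (size₂ S))))
    where
    in-X₁ : ∀ i → S (ι₁ i) ∧ adj G (ιY k) (ι₁ i) ≡ S (ι₁ i)
    in-X₁ i rewrite part-ιY k | part-ι₁ i = ∧-identityʳ _
    in-X₂ : ∀ i → S (ι₂ i) ∧ adj G (ιY k) (ι₂ i) ≡ S (ι₂ i)
    in-X₂ i rewrite part-ιY k | part-ι₂ i = ∧-identityʳ _
    in-Y : ∀ l → S (ιY l) ∧ adj G (ιY k) (ιY l) ≡ false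
    in-Y l rewrite part-ιY k | part-ιY l = ∧-zeroʳ _

-- A block of at most m+1 vertices cannot outweigh m+2 vertices of Y.
Y-outweighs : ∀ {m p q s} → p + s ≤ q + 0 → s ≡ suc (suc m) → q ≤ suc m → ⊥
Y-outweighs {m} {p} {q} {s} h refl q≤ = 1+n≰n (begin
  suc (suc m) ≤⟨ m≤n+m s p ⟩
  p + s       ≤⟨ h ⟩
  q + 0       ≡⟨ +-identityʳ q ⟩
  q           ≤⟨ q≤ ⟩
  suc m       ∎)
  where open ≤-Reasoning

unique-solution : ∀ m c → c + (m ∸ 1 + c) ≡ suc m → c ≡ 1
unique-solution m (suc zero) _ = refl
unique-solution zero zero ()
unique-solution (suc k) zero e = ⊥-elim (
  1+n≰n (≤-trans (≤-reflexive (≡-sym e)) (≤-trans (≤-reflexive (+-identityʳ k)) (n≤1+n k))))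
unique-solution zero (suc (suc c)) ()
unique-solution (suc k) (suc (suc c)) e = ⊥-elim (
  m+1+n≰m k (≤-trans (m≤n+m (k + suc (suc c)) c) (≤-reflexive (cong (λ x → x ∸ 2) e))))

no-surplus : ∀ {d x y a b} → y ≤ d → 1 ≤ x → d + b ≤ a → x + a ≤ y + b → ⊥
no-surplus {d} {x} {y} {a} {b} y≤d 1≤x surplus h = <-irrefl refl (begin-strict
  y + b       ≤⟨ +-monoˡ-≤ b y≤d ⟩
  d + b       <⟨ +-monoˡ-≤ (d + b) 1≤x ⟩
  x + (d + b) ≤⟨ +-monoʳ-≤ x surplus ⟩
  x + a       ≤⟨ h ⟩
  y + b       ∎)
  where open ≤-Reasoning

module Cohesion {m : ℕ} {X₂ : SimpleGraph (suc m)} (σ : CohesiveSplit (Q m X₂)) where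
  open Blocks m X₂
  open CohesiveSplit σ

  size₂-total : size₂ S + size₂ T ≡ suc m
  size₂-total = count-complement {S = λ j → S (ι₂ j)} (λ j → complement (ι₂ j))

  sizeY-total : sizeY S + sizeY T ≡ suc (suc m)
  sizeY-total = count-complement {S = λ k → S (ιY k)} (λ k → complement (ιY k))

  -- (1) If T is nonempty then T meets Y: otherwise Y ⊆ S, and a vertex of T
  -- would have all m+2 vertices of Y as S-neighbours.
  T-meets-Y : (∃ λ b → T b ≡ true) → ∃ λ k → T (ιY k) ≡ true
  T-meets-Y (b , tb) = count-ex (λ k → T (ιY k)) (T-inside-Y (block b) tb)
    where
    Y-in-S : sizeY T ≡ 0 → sizeY S ≡ suc (suc m)
    Y-in-S none = trans (≡-sym (+-identityʳ (sizeY S)))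
      (trans (cong (sizeY S +_) (≡-sym none)) sizeY-total)

    T-inside-Y : ∀ {b} → BlockView b → T b ≡ true → 1 ≤ sizeY T
    T-inside-Y (atY k) tb = count-pos (λ l → T (ιY l)) k tb
    T-inside-Y (atX₁ i) tb with sizeY T in none
    ... | suc _ = s≤s z≤n
    ... | zero  = ⊥-elim (Y-outweighs
      (subst₂ _≤_ (degIn-X₁ S i) (trans (degIn-X₁ T i) (cong (nbr₁ T i +_) none)) (T-cohesive (ι₁ i) tb))
      (Y-in-S none) (≤-trans (count-≤ _) (≤-trans (m∸n≤m m 1) (n≤1+n m))))
    T-inside-Y (atX₂ j) tb with sizeY T in none
    ... | suc _ = s≤s z≤n
    ... | zero  = ⊥-elim (Y-outweighs
      (subst₂ _≤_ (degIn-X₂ S j) (trans (degIn-X₂ T j) (cong (nbr₂ T j +_) none)) (T-cohesive (ι₂ j) tb))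
      (Y-in-S none) (count-≤ (λ l → T (ι₂ l) ∧ adj X₂ j l)))

  -- (2) A vertex of S ∩ X₁ sees all of T ∩ (X₁ ∪ Y) and all of S ∩ (X₁ ∪ Y)
  -- but itself, so cohesion at it makes S strictly heavier on X₁ ∪ Y.
  X₁-vertex-in-S : ∀ i → S (ι₁ i) ≡ true → size₁ T + sizeY T < size₁ S + sizeY S
  X₁-vertex-in-S i si = begin-strict
    size₁ T + sizeY T  ≡⟨ cong (_+ sizeY T) (≡-sym (count-without-absent _ i (disjoint (ι₁ i) si))) ⟩
    nbr₁ T i + sizeY T ≡⟨ ≡-sym (degIn-X₁ T i) ⟩
    degIn G T (ι₁ i)   ≤⟨ S-cohesive (ι₁ i) si ⟩
    degIn G S (ι₁ i)   ≡⟨ degIn-X₁ S i ⟩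
    nbr₁ S i + sizeY S <⟨ +-monoˡ-≤ (sizeY S) (count-without-present _ i si) ⟩
    size₁ S + sizeY S  ∎
    where open ≤-Reasoning

  -- (3) If X₁ ⊆ S and Y meets both sides, then a Y-vertex in S and one in T
  -- see exactly X₁ ∪ X₂, forcing size₂ T = (m-1) + size₂ S, so size₂ S = 1.
  X₂-meets-S-once : (∀ i → S (ι₁ i) ≡ true) →
    ∀ k₁ k₂ → S (ιY k₁) ≡ true → T (ιY k₂) ≡ true → size₂ S ≡ 1
  X₂-meets-S-once X₁⊆S k₁ k₂ s₁ t₂ =
    unique-solution m (size₂ S) (trans (cong (size₂ S +_) (≡-sym balance)) size₂-total)
    where
    size₁-S : size₁ S ≡ m ∸ 1
    size₁-S = count-true X₁⊆S
    size₁-T : size₁ T ≡ 0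
    size₁-T = count-false (λ i → disjoint (ι₁ i) (X₁⊆S i))
    seen-by-Y : ∀ k → degIn G S (ιY k) ≡ m ∸ 1 + size₂ S × degIn G T (ιY k) ≡ size₂ T
    seen-by-Y k = trans (degIn-Y S k) (cong (_+ size₂ S) size₁-S) , trans (degIn-Y T k) (cong (_+ size₂ T) size₁-T)
    balance : size₂ T ≡ m ∸ 1 + size₂ S
    balance = ≤-antisym
      (subst₂ _≤_ (proj₂ (seen-by-Y k₁)) (proj₁ (seen-by-Y k₁)) (S-cohesive (ιY k₁) s₁))
      (subst₂ _≤_ (proj₁ (seen-by-Y k₂)) (proj₂ (seen-by-Y k₂)) (T-cohesive (ιY k₂) t₂))

  -- (4) If X₂ is regular of positive degree, S ∩ X₂ cannot be a single
  -- vertex v: v has all its suc d neighbours in T, so cohesion at v gives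
  -- sizeY S ≥ suc d + sizeY T, while a neighbour w ∈ T of v has the
  -- S-neighbour v and at most suc d neighbours in X₂, so it is not cohesive.
  lonely-vertex : ∀ {d} → Regular (suc d) X₂ → size₂ S ≡ 1 → ∀ v → S (ι₂ v) ≡ true → ⊥
  lonely-vertex {d} reg one v sv with count-ex (adj X₂ v) (subst (1 ≤_) (≡-sym (reg v)) (s≤s z≤n))
  ... | w , vw = no-surplus T-nbrs-of-w S-nbr-of-w Y-surplus
                   (subst₂ _≤_ (degIn-X₂ S w) (degIn-X₂ T w) (T-cohesive (ι₂ w) w-in-T))
    where
    nbr₂-split : ∀ j → nbr₂ S j + nbr₂ T j ≡ suc d
    nbr₂-split j = trans (≡-sym (count-∧-split (λ i → complement (ι₂ i)) (adj X₂ j))) (reg j)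

    no-S-nbr : nbr₂ S v ≡ 0
    no-S-nbr = n≤0⇒n≡0 (s≤s⁻¹ (subst (nbr₂ S v <_) one
      (count-strict _ (λ j → S (ι₂ j)) (λ j → ∧-trueˡ) v sv
                    (trans (cong (S (ι₂ v) ∧_) (irrefl X₂ v)) (∧-zeroʳ _)))))

    Y-surplus : suc d + sizeY T ≤ sizeY S
    Y-surplus = subst₂ _≤_
      (trans (degIn-X₂ T v) (cong (_+ sizeY T) (trans (≡-sym (cong (_+ nbr₂ T v) no-S-nbr)) (nbr₂-split v))))
      (trans (degIn-X₂ S v) (cong (_+ sizeY S) no-S-nbr))
      (S-cohesive (ι₂ v) sv)

    w-in-T : T (ι₂ w) ≡ true
    w-in-T with S (ι₂ w) in sw
    ... | false = S-false⇒T (ι₂ w) sw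
    ... | true  = ⊥-elim (1+n≰n (subst (1 ≤_) no-S-nbr (count-pos (λ j → S (ι₂ j) ∧ adj X₂ v j) w (∧-true sw vw))))

    S-nbr-of-w : 1 ≤ nbr₂ S w
    S-nbr-of-w = count-pos (λ j → S (ι₂ j) ∧ adj X₂ w j) v (∧-true sv (trans (sym X₂ w v) vw))

    T-nbrs-of-w : nbr₂ T w ≤ suc d
    T-nbrs-of-w = subst (nbr₂ T w ≤_) (nbr₂-split w) (m≤n+m (nbr₂ T w) (nbr₂ S w))

module _ {m : ℕ} {X₂ : SimpleGraph (suc m)} where
  open Blocks m X₂
  open CohesiveSplit using (S; T; S-false⇒T)

  -- (2) X₁ lies on one side: vertices of X₁ on both sides would make each
  -- side strictly heavier than the other on X₁ ∪ Y.
  X₁-one-sided : (σ : CohesiveSplit (Q m X₂)) →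
    ∀ i → S σ (ι₁ i) ≡ true → ∀ j → S σ (ι₁ j) ≡ true
  X₁-one-sided σ i si j with S σ (ι₁ j) in sj
  ... | true  = refl
  ... | false = ⊥-elim (<-asym (Cohesion.X₁-vertex-in-S σ i si)
                               (Cohesion.X₁-vertex-in-S (swap σ) j (S-false⇒T σ (ι₁ j) sj)))

  X₁-inside-S-impossible : ∀ {d} → Regular (suc d) X₂ → (σ : CohesiveSplit (Q m X₂)) →
    (∀ i → S σ (ι₁ i) ≡ true) → (∃ λ a → S σ a ≡ true) → (∃ λ b → T σ b ≡ true) → ⊥
  X₁-inside-S-impossible reg σ X₁⊆S S-nonempty T-nonempty =
    let k₁ , s₁ = Cohesion.T-meets-Y (swap σ) S-nonempty
        k₂ , t₂ = Cohesion.T-meets-Y σ T-nonempty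
        once    = Cohesion.X₂-meets-S-once σ X₁⊆S k₁ k₂ s₁ t₂
        v  , sv = count-ex (λ j → S σ (ι₂ j)) (≤-reflexive (≡-sym once))
    in Cohesion.lonely-vertex σ reg once v sv

  no-cohesive-split : ∀ {d} → Regular (suc d) X₂ → Fin (m ∸ 1) → (σ : CohesiveSplit (Q m X₂)) →
    (∃ λ a → S σ a ≡ true) → (∃ λ b → T σ b ≡ true) → ⊥
  no-cohesive-split reg x σ S-nonempty T-nonempty with S σ (ι₁ x) in sx
  ... | true  = X₁-inside-S-impossible reg σ (X₁-one-sided σ x sx) S-nonempty T-nonempty
  ... | false = X₁-inside-S-impossible reg (swap σ) (X₁-one-sided (swap σ) x (S-false⇒T σ (ι₁ x) sx))
                                       T-nonempty S-nonempty

proposition5 : (m : ℕ) → 2 < m → (X₂ : SimpleGraph (suc m)) → Regular (m ∸ 2) X₂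
    → ¬ InternalPartition (Q m X₂)
proposition5 (suc (suc (suc n))) (s≤s (s≤s (s≤s _))) X₂ reg ip with InternalPartition.B-nonempty ip
... | b , ab = no-cohesive-split reg zero (internal⇒cohesive ip)
                 (InternalPartition.A-nonempty ip) (b , cong not ab)
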